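{- Let $n=2k+1$ be odd with $k\ge 1$, and let $a\in\mathbb{F}_{2^n}^*$. Let $f:\mathbb{F}_{2^n}\to\mathbb{F}_{2^n}$ be $f(x)=x+a^{ -1}\mathrm{Tr}(a^3x^3)$. Then the image set $D=f(\mathbb{F}_{2^n})$ is a $(2^{2k},2,2^{2k},2^{2k-1})$ relative difference set in $(\mathbb{F}_{2^n},+)$ relative to the subgroup $N=\{0,a^{ -1}\}$.
   Context: $\mathrm{Tr}$ denotes the absolute trace $\mathrm{Tr}(x)=\sum_{i=0}^{n-1}x^{2^i}$ from $\mathbb{F}_{2^n}$ to $\mathbb{F}_2$ (viewed inside $\mathbb{F}_{2^n}$). Let $G$ be a finite group of order $mn'$ with a normal subgroup $N$ of order $n'$. A $k'$-subset $R\subseteq G$ is an $(m,n',k',\lambda)$ relative difference set relative to $N$ if the list of differences $r-r'$ with $r,r'\in R$, $r\ne r'$, covers every element of $G\setminus N$ exactly $\lambda$ times and covers no element of $N\setminus\{0\}$. -}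

module Defs where

open import Level using (0ℓ)
open import Data.Nat as ℕ using (ℕ; zero; suc; _^_)
open import Data.Bool using (Bool; true; false; _∧_; _∨_; not; if_then_else_)
open import Data.Fin using (Fin)
import Data.Fin.Properties as FinP
open import Data.List using (List; []; _∷_; map; length; foldr; upTo; allFin; filterᵇ; concatMap)
open import Data.Bool.ListAction using (any)
open import Data.Product using (_×_; _,_)
open import Function.Bundles using (_↔_; Inverse)
open import Relation.Nullary using (¬_; Dec; yes; no)
open import Relation.Nullary.Decidable using (⌊_⌋)
open import Relation.Binary.PropositionalEquality using (_≡_; _≢_; refl; sym; trans; cong)
open import Algebra.Structures using (IsCommutativeRing)

-- A finite field with exactly 2^n elements (all such fields are isomorphic
-- to F_{2^n}).  Equality is propositional equality on the carrier.
record GF2 (n : ℕ) : Set₁ where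
  infixl 7 _*_
  infixl 6 _+_
  field
    Carrier : Set
    _+_ _*_ : Carrier → Carrier → Carrier
    -_      : Carrier → Carrier
    0# 1#   : Carrier
    isCommutativeRing : IsCommutativeRing _≡_ _+_ _*_ -_ 0# 1#
    _⁻¹     : Carrier → Carrier
    0≢1     : 0# ≢ 1#
    inverse : ∀ x → x ≢ 0# → x * (x ⁻¹) ≡ 1#
    enum    : Carrier ↔ Fin (2 ^ n)

  _≟_ : (x y : Carrier) → Dec (x ≡ y)
  x ≟ y with Inverse.to enum x FinP.≟ Inverse.to enum y
  ... | yes p = yes (trans (sym (Inverse.strictlyInverseʳ enum x))
                     (trans (cong (Inverse.from enum) p) (Inverse.strictlyInverseʳ enum y)))
  ... | no ¬p = no (λ e → ¬p (cong (Inverse.to enum) e))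

  _==_ : Carrier → Carrier → Bool
  x == y = ⌊ x ≟ y ⌋

  elems : List Carrier
  elems = map (Inverse.from enum) (allFin (2 ^ n))

  count : (Carrier → Bool) → ℕ
  count P = length (filterᵇ P elems)

  count₂ : (Carrier → Carrier → Bool) → ℕ
  count₂ P = length (filterᵇ (λ { (x , y) → P x y })
                       (concatMap (λ x → map (λ y → (x , y)) elems) elems))

  pow : Carrier → ℕ → Carrier
  pow x zero    = 1#
  pow x (suc m) = x * pow x m

  Tr : Carrier → Carrier
  Tr x = foldr _+_ 0# (map (λ i → pow x (2 ^ i)) (upTo n))

  image : (Carrier → Carrier) → Carrier → Bool
  image f y = any (λ x → f x == y) elems

  record IsRDS (R N : Carrier → Bool) (m n' k' λ' : ℕ) : Set where
    field
      group-order : 2 ^ n ≡ m ℕ.* n'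
      N-zero      : N 0# ≡ true
      N-closed    : ∀ x y → N x ≡ true → N y ≡ true → N (x + (- y)) ≡ true
      N-order     : count N ≡ n'
      R-size      : count R ≡ k'
      diffs-out   : ∀ g → N g ≡ false →
                    count₂ (λ r r' → R r ∧ R r' ∧ not (r == r') ∧ ((r + (- r')) == g)) ≡ λ'
      diffs-in    : ∀ g → N g ≡ true → g ≢ 0# →
                    count₂ (λ r r' → R r ∧ R r' ∧ not (r == r') ∧ ((r + (- r')) == g)) ≡ 0

  fMap : Carrier → Carrier → Carrier
  fMap a x = x + (a ⁻¹) * Tr (pow a 3 * pow x 3)

  NSet : Carrier → Carrier → Bool
  NSet a y = (y == 0#) ∨ (y == (a ⁻¹))

module Submission where

-- Write b = a⁻¹ and t y = Tr (a³ y³), so that f y = y + b · t y. In characteristic 2,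
-- (u + v)³ + u³ = u²v + uv² + v³ and Tr (u²v) = Tr (u √v), hence
-- t (y + g) + t y = Tr (c y + (a g)³) with c = a (√(a g) + (a g)²), an affine function of y.
-- For g = b we get c = 0 and, n being odd, Tr 1 = 1, so t (y + b) = t y + 1: f fixes the zeros
-- of t and moves every other point onto one, so D = f(𝔽) = {t = 0} has half of the 2ⁿ elements
-- and is disjoint from D + b. For g ∉ {0, b} we get c ≠ 0 (else a g would satisfy x⁴ = x,
-- forcing a g ∈ {0, 1} as n is odd), so y ↦ t (y + g) + t y is balanced. Then D, D − g and the
-- set where their indicators agree all have 2ⁿ⁻¹ elements, and inclusion–exclusion gives
-- |D ∩ (D − g)| = 2ⁿ⁻², the number of ways of writing g as a difference of elements of D.

open import Algebra.Bundles using (CommutativeMonoid; CommutativeRing)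
open import Algebra.Structures using (IsCommutativeRing)
open import Data.Bool using (Bool; true; false; not; _∧_; _∨_; _xor_; if_then_else_)
open import Data.Bool.Properties using (not-involutive; ∧-zeroʳ; ∧-identityʳ; ∧-inverseʳ; ∨-zeroʳ; T-≡; ⇔→≡)
open import Data.Fin as Fin using (Fin; punchIn)
open import Data.Fin.Permutation using (Permutation; permutation; _⟨$⟩ʳ_)
open import Data.Fin.Properties using (punchInᵢ≢i; toℕ-inject₁; toℕ-fromℕ)
open import Data.List using (List; []; _∷_; _++_; map; length; filterᵇ; concatMap; tabulate; allFin; foldr; applyUpTo)
open import Data.List.Membership.Propositional using (_∈_; lose)
open import Data.List.Membership.Propositional.Properties using (∈-map⁺; ∈-allFin)
open import Data.List.Properties using (map-++; map-∘; map-cong; map-tabulate)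
open import Data.List.Relation.Unary.Any using (satisfied)
open import Data.List.Relation.Unary.Any.Properties using (any⁺; any⁻)
open import Data.Nat as ℕ using (ℕ; zero; suc; _^_)
open import Data.Nat.ListAction using () renaming (sum to sumˡ)
open import Data.Nat.ListAction.Properties using () renaming (sum-++ to sumˡ-++)
import Data.Nat.Properties as ℕ
open import Data.Nat.Tactic.RingSolver using (solve-∀)
open import Data.Product as Prod using (_,_; ∃)
open import Data.Sum using (_⊎_; inj₁; inj₂; [_,_])
open import Data.Vec.Functional using (Vector)
open import Function using (id; _∘_; Inverse; _↔_; Equivalence; mk⇔)
open import Level using (0ℓ)
open import Relation.Binary.PropositionalEquality as ≡ using (_≡_; _≢_)
open import Relation.Nullary using (yes; no; contradiction)
import Algebra.Definitions.RawMonoid ℕ.+-0-rawMonoid as ℕ∑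

open import Defs

toℕ : Bool → ℕ
toℕ false = 0
toℕ true  = 1

length-filterᵇ : ∀ {A : Set} (p : A → Bool) xs → length (filterᵇ p xs) ≡ sumˡ (map (toℕ ∘ p) xs)
length-filterᵇ p []       = ≡.refl
length-filterᵇ p (x ∷ xs) with p x
... | true  = ≡.cong suc (length-filterᵇ p xs)
... | false = length-filterᵇ p xs

sumˡ-map-concatMap : ∀ {A B : Set} (h : B → ℕ) (G : A → List B) xs →
                    sumˡ (map h (concatMap G xs)) ≡ sumˡ (map (λ x → sumˡ (map h (G x))) xs)
sumˡ-map-concatMap h G []       = ≡.refl
sumˡ-map-concatMap h G (x ∷ xs) = begin
  sumˡ (map h (G x ++ concatMap G xs))                ≡⟨ ≡.cong sumˡ (map-++ h (G x) (concatMap G xs)) ⟩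
  sumˡ (map h (G x) ++ map h (concatMap G xs))        ≡⟨ sumˡ-++ (map h (G x)) (map h (concatMap G xs)) ⟩
  sumˡ (map h (G x)) ℕ.+ sumˡ (map h (concatMap G xs)) ≡⟨ ≡.cong (sumˡ (map h (G x)) ℕ.+_) (sumˡ-map-concatMap h G xs) ⟩
  sumˡ (map h (G x)) ℕ.+ sumˡ (map (λ x → sumˡ (map h (G x))) xs) ∎
  where open ≡.≡-Reasoning

sumˡ-tabulate : ∀ {m} (f : Fin m → ℕ) → sumˡ (tabulate f) ≡ ℕ∑.sum f
sumˡ-tabulate {zero}  f = ≡.refl
sumˡ-tabulate {suc m} f = ≡.cong (f Fin.zero ℕ.+_) (sumˡ-tabulate (f ∘ Fin.suc))

module EnumeratedSum (M : CommutativeMonoid 0ℓ 0ℓ) {A : Set} {m : ℕ} (enum : A ↔ Fin m) where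

  open CommutativeMonoid M
  open import Algebra.Properties.CommutativeMonoid.Sum M
  open import Algebra.Definitions.RawMonoid rawMonoid using (_×_)
  open import Relation.Binary.Reasoning.Setoid setoid
  open Inverse enum using (to; from; strictlyInverseˡ; strictlyInverseʳ)

  ∑ : (A → Carrier) → Carrier
  ∑ f = sum (f ∘ from)

  ∑-cong : ∀ {f g : A → Carrier} → (∀ x → f x ≈ g x) → ∑ f ≈ ∑ g
  ∑-cong f≈g = sum-cong-≋ (f≈g ∘ from)

  ∑-distrib : ∀ (f g : A → Carrier) → ∑ (λ x → f x ∙ g x) ≈ ∑ f ∙ ∑ g
  ∑-distrib f g = ∑-distrib-+ (f ∘ from) (g ∘ from)

  ∑-const : ∀ x → ∑ (λ _ → x) ≈ m × x
  ∑-const x = sum-replicate m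

  ∑-zero : ∀ {f : A → Carrier} → (∀ x → f x ≈ ε) → ∑ f ≈ ε
  ∑-zero {f} f≈ε = trans (∑-cong f≈ε) (sum-replicate-zero m)

  ∑-reindex : ∀ (σ τ : A → A) → (∀ x → τ (σ x) ≡ x) → (∀ x → σ (τ x) ≡ x) →
              (f : A → Carrier) → ∑ (f ∘ σ) ≈ ∑ f
  ∑-reindex σ τ τσ στ f = begin
    sum (f ∘ σ ∘ from)                   ≈⟨ sum-permute (f ∘ σ ∘ from) π ⟩
    sum (f ∘ σ ∘ from ∘ (π ⟨$⟩ʳ_))       ≡⟨ sum-cong-≗ (λ i → ≡.cong (f ∘ σ) (strictlyInverseʳ (τ (from i)))) ⟩
    sum (f ∘ σ ∘ τ ∘ from)               ≡⟨ sum-cong-≗ (λ i → ≡.cong f (στ (from i))) ⟩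
    sum (f ∘ from)                       ∎
    where
    conj : ∀ (φ ψ : A → A) → (∀ x → φ (ψ x) ≡ x) → ∀ i → to (φ (from (to (ψ (from i))))) ≡ i
    conj φ ψ φψ i = ≡.trans (≡.cong (to ∘ φ) (strictlyInverseʳ (ψ (from i))))
                      (≡.trans (≡.cong to (φψ (from i))) (strictlyInverseˡ i))
    π : Permutation m m
    π = permutation (to ∘ τ ∘ from) (to ∘ σ ∘ from) (conj τ σ τσ) (conj σ τ στ)

  ∑-closed : ∀ (Q : Carrier → Set) → Q ε → (∀ {x y} → Q x → Q y → Q (x ∙ y)) →
             ∀ {f : A → Carrier} → (∀ x → Q (f x)) → Q (∑ f)
  ∑-closed Q Qε Q∙ Qf = sum-closed (Qf ∘ from)
    where
    sum-closed : ∀ {k} {t : Vector Carrier k} → (∀ i → Q (t i)) → Q (sum t)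
    sum-closed {zero}  Qt = Qε
    sum-closed {suc k} Qt = Q∙ (Qt Fin.zero) (sum-closed (Qt ∘ Fin.suc))

  ∑-delta : ∀ {f : A → Carrier} (c : A) → (∀ x → x ≢ c → f x ≈ ε) → ∑ f ≈ f c
  ∑-delta {f} c f≈ε = trans (sum-delta (f ∘ from) (to c) f∘from≈ε) (reflexive (≡.cong f (strictlyInverseʳ c)))
    where
    f∘from≈ε : ∀ i → i ≢ to c → f (from i) ≈ ε
    f∘from≈ε i i≢c = f≈ε (from i) (λ e → i≢c (≡.trans (≡.sym (strictlyInverseˡ i)) (≡.cong to e)))
    sum-delta : ∀ {k} (t : Vector Carrier k) (j : Fin k) → (∀ i → i ≢ j → t i ≈ ε) → sum t ≈ t j
    sum-delta {suc k} t j t≈ε = begin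
      sum t                     ≈⟨ sum-remove t ⟩
      t j ∙ sum (t ∘ punchIn j) ≈⟨ ∙-congˡ (trans (sum-cong-≋ (λ i → t≈ε (punchIn j i) (punchInᵢ≢i j i))) (sum-replicate-zero k)) ⟩
      t j ∙ ε                   ≈⟨ identityʳ (t j) ⟩
      t j                       ∎

module FiniteField {n : ℕ} (F : GF2 n) where

  open GF2 F
  open IsCommutativeRing isCommutativeRing using
    ( +-assoc; +-comm; +-identityˡ; +-identityʳ; distribˡ
    ; *-assoc; *-comm; *-identityˡ; *-identityʳ; zeroˡ; zeroʳ )

  ring : CommutativeRing 0ℓ 0ℓ
  ring = record { isCommutativeRing = isCommutativeRing }

  open CommutativeRing ring using (+-commutativeMonoid; *-commutativeMonoid; commutativeSemiring; semiring; +-group)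
  open import Algebra.Properties.Semiring.Mult semiring using (_×_; ×-homo-+; ×1-homo-*)
  open import Algebra.Definitions.RawMonoid (CommutativeRing.*-rawMonoid ring) using () renaming (_×_ to _×*_)
  open import Algebra.Properties.CommutativeMonoid.Sum +-commutativeMonoid using (sum; ∑-distrib-+; sum-cong-≗; sum-replicate; sum-init-last)
  open import Algebra.Properties.Group +-group using (//-rightDividesˡ; //-rightDividesʳ; identityʳ-unique; inverseˡ-unique)
    renaming (∙-cancelˡ to +-cancelˡ; ∙-cancelʳ to +-cancelʳ)
  open import Algebra.Solver.Ring.NaturalCoefficients.Default commutativeSemiring using (solve; _:=_; _:+_; _:*_; con)

  module Add = EnumeratedSum +-commutativeMonoid enum
  module Mul = EnumeratedSum *-commutativeMonoid enum
  module Count = EnumeratedSum ℕ.+-0-commutativeMonoid enum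

  ==-true : ∀ {x y} → x ≡ y → (x == y) ≡ true
  ==-true {x} {y} x≡y with x ≟ y
  ... | yes _   = ≡.refl
  ... | no x≢y = contradiction x≡y x≢y

  ==-false : ∀ {x y} → x ≢ y → (x == y) ≡ false
  ==-false {x} {y} x≢y with x ≟ y
  ... | yes x≡y = contradiction x≡y x≢y
  ... | no _    = ≡.refl

  ==-sound : ∀ {x y} → (x == y) ≡ true → x ≡ y
  ==-sound {x} {y} x==y with x ≟ y
  ... | yes x≡y = x≡y

  1≢0 : 1# ≢ 0#
  1≢0 1≡0 = 0≢1 (≡.sym 1≡0)

  *-cancelˡ : ∀ x {y z} → x ≢ 0# → x * y ≡ x * z → y ≡ z
  *-cancelˡ x {y} {z} x≢0 xy≡xz = begin
    y                ≡⟨ *-identityˡ y ⟨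
    1# * y           ≡⟨ ≡.cong (_* y) (inverse x x≢0) ⟨
    (x * x ⁻¹) * y   ≡⟨ solve 3 (λ x x' y → (x :* x') :* y := x' :* (x :* y)) ≡.refl x (x ⁻¹) y ⟩
    x ⁻¹ * (x * y)   ≡⟨ ≡.cong (x ⁻¹ *_) xy≡xz ⟩
    x ⁻¹ * (x * z)   ≡⟨ solve 3 (λ x x' y → (x :* x') :* y := x' :* (x :* y)) ≡.refl x (x ⁻¹) z ⟨
    (x * x ⁻¹) * z   ≡⟨ ≡.cong (_* z) (inverse x x≢0) ⟩
    1# * z           ≡⟨ *-identityˡ z ⟩
    z                ∎
    where open ≡.≡-Reasoning

  *-≡0 : ∀ x y → x * y ≡ 0# → x ≡ 0# ⊎ y ≡ 0#
  *-≡0 x y xy≡0 with x ≟ 0#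
  ... | yes x≡0 = inj₁ x≡0
  ... | no x≢0  = inj₂ (*-cancelˡ x x≢0 (≡.trans xy≡0 (≡.sym (zeroʳ x))))

  *-≢0 : ∀ {x y} → x ≢ 0# → y ≢ 0# → x * y ≢ 0#
  *-≢0 x≢0 y≢0 xy≡0 = [ x≢0 , y≢0 ] (*-≡0 _ _ xy≡0)

  ⁻¹-≢0 : ∀ x → x ≢ 0# → x ⁻¹ ≢ 0#
  ⁻¹-≢0 x x≢0 x⁻¹≡0 = 0≢1 (≡.trans (≡.sym (zeroʳ x)) (≡.trans (≡.cong (x *_) (≡.sym x⁻¹≡0)) (inverse x x≢0)))

  -- Counting

  sumˡ-map-elems : ∀ (g : Carrier → ℕ) → sumˡ (map g elems) ≡ Count.∑ g
  sumˡ-map-elems g = begin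
    sumˡ (map g (map (Inverse.from enum) (allFin (2 ^ n)))) ≡⟨ ≡.cong sumˡ (map-∘ (allFin (2 ^ n))) ⟨
    sumˡ (map (g ∘ Inverse.from enum) (tabulate id))      ≡⟨ ≡.cong sumˡ (map-tabulate id (g ∘ Inverse.from enum)) ⟩
    sumˡ (tabulate (g ∘ Inverse.from enum))               ≡⟨ sumˡ-tabulate (g ∘ Inverse.from enum) ⟩
    Count.∑ g                                             ∎
    where open ≡.≡-Reasoning

  count-∑ : ∀ P → count P ≡ Count.∑ (toℕ ∘ P)
  count-∑ P = ≡.trans (length-filterᵇ P elems) (sumˡ-map-elems (toℕ ∘ P))

  count₂-∑ : ∀ P → count₂ P ≡ Count.∑ (λ x → count (P x))
  count₂-∑ P = begin
    count₂ P                                                   ≡⟨ length-filterᵇ _ pairs ⟩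
    sumˡ (map (toℕ ∘ P′) pairs)                                ≡⟨ sumˡ-map-concatMap (toℕ ∘ P′) (λ x → map (x ,_) elems) elems ⟩
    sumˡ (map (λ x → sumˡ (map (toℕ ∘ P′) (map (x ,_) elems))) elems)
        ≡⟨ ≡.cong sumˡ (map-cong (λ x → ≡.trans (≡.cong sumˡ (≡.sym (map-∘ elems))) (≡.sym (length-filterᵇ (P x) elems))) elems) ⟩
    sumˡ (map (λ x → count (P x)) elems)                       ≡⟨ sumˡ-map-elems (λ x → count (P x)) ⟩
    Count.∑ (λ x → count (P x))                                ∎
    where
    open ≡.≡-Reasoning
    pairs : List (Carrier Prod.× Carrier)
    pairs = concatMap (λ x → map (x ,_) elems) elems
    P′ : Carrier Prod.× Carrier → Bool
    P′ (x , y) = P x y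

  ∈-elems : ∀ y → y ∈ elems
  ∈-elems y = ≡.subst (_∈ elems) (Inverse.strictlyInverseʳ enum y) (∈-map⁺ (Inverse.from enum) (∈-allFin (Inverse.to enum y)))

  image-elim : ∀ {f : Carrier → Carrier} {y} → image f y ≡ true → ∃ λ x → f x ≡ y
  image-elim {f} {y} y∈ with satisfied (any⁻ (λ x → f x == y) elems (Equivalence.from T-≡ y∈))
  ... | x , fx==y = x , ==-sound (Equivalence.to T-≡ fx==y)

  image-intro : ∀ {f : Carrier → Carrier} {y} x → f x ≡ y → image f y ≡ true
  image-intro {f} {y} x fx≡y = Equivalence.to T-≡ (any⁺ (λ x → f x == y) (lose (∈-elems x) (Equivalence.from T-≡ (==-true fx≡y))))

  count-cong : ∀ {P Q : Carrier → Bool} → (∀ y → P y ≡ Q y) → count P ≡ count Q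
  count-cong {P} {Q} P≗Q = ≡.trans (count-∑ P) (≡.trans (Count.∑-cong (≡.cong toℕ ∘ P≗Q)) (≡.sym (count-∑ Q)))

  count-reindex : ∀ (σ τ : Carrier → Carrier) → (∀ x → τ (σ x) ≡ x) → (∀ x → σ (τ x) ≡ x) →
                  ∀ P → count (P ∘ σ) ≡ count P
  count-reindex σ τ τσ στ P =
    ≡.trans (count-∑ (P ∘ σ)) (≡.trans (Count.∑-reindex σ τ τσ στ (toℕ ∘ P)) (≡.sym (count-∑ P)))

  count-all : count (λ _ → true) ≡ 2 ^ n
  count-all = ≡.trans (count-∑ (λ _ → true)) (≡.trans (Count.∑-const 1) (×1 (2 ^ n)))
    where
    ×1 : ∀ m → m ℕ∑.× 1 ≡ m
    ×1 zero    = ≡.refl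
    ×1 (suc m) = ≡.cong suc (×1 m)

  count-complement : ∀ P → count (not ∘ P) ℕ.+ count P ≡ 2 ^ n
  count-complement P = begin
    count (not ∘ P) ℕ.+ count P                     ≡⟨ ≡.cong₂ ℕ._+_ (count-∑ (not ∘ P)) (count-∑ P) ⟩
    Count.∑ (toℕ ∘ not ∘ P) ℕ.+ Count.∑ (toℕ ∘ P)   ≡⟨ Count.∑-distrib (toℕ ∘ not ∘ P) (toℕ ∘ P) ⟨
    Count.∑ (λ y → toℕ (not (P y)) ℕ.+ toℕ (P y))   ≡⟨ Count.∑-cong (λ y → toℕ-not+toℕ (P y)) ⟩
    Count.∑ (λ _ → 1)                               ≡⟨ count-∑ (λ _ → true) ⟨
    count (λ _ → true)                              ≡⟨ count-all ⟩
    2 ^ n                                           ∎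
    where
    open ≡.≡-Reasoning
    toℕ-not+toℕ : ∀ b → toℕ (not b) ℕ.+ toℕ b ≡ 1
    toℕ-not+toℕ true  = ≡.refl
    toℕ-not+toℕ false = ≡.refl

  count-none : ∀ {P : Carrier → Bool} → (∀ y → P y ≡ false) → count P ≡ 0
  count-none {P} P≡false = ≡.trans (count-∑ P) (Count.∑-zero (≡.cong toℕ ∘ P≡false))

  count-delta : ∀ {P : Carrier → Bool} c → (∀ y → y ≢ c → P y ≡ false) → count P ≡ toℕ (P c)
  count-delta {P} c P≡false = ≡.trans (count-∑ P) (Count.∑-delta c (λ y y≢c → ≡.cong toℕ (P≡false y y≢c)))

  count-pair : ∀ {c d} → c ≢ d → count (λ y → (y == c) ∨ (y == d)) ≡ 2
  count-pair {c} {d} c≢d = begin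
    count (λ y → (y == c) ∨ (y == d))                     ≡⟨ count-∑ _ ⟩
    Count.∑ (λ y → toℕ ((y == c) ∨ (y == d)))             ≡⟨ Count.∑-cong toℕ-∨ ⟩
    Count.∑ (λ y → toℕ (y == c) ℕ.+ toℕ (y == d))         ≡⟨ Count.∑-distrib (toℕ ∘ (_== c)) (toℕ ∘ (_== d)) ⟩
    Count.∑ (toℕ ∘ (_== c)) ℕ.+ Count.∑ (toℕ ∘ (_== d))   ≡⟨ ≡.cong₂ ℕ._+_ (count-∑ (_== c)) (count-∑ (_== d)) ⟨
    count (_== c) ℕ.+ count (_== d)                       ≡⟨ ≡.cong₂ ℕ._+_ (count-single c) (count-single d) ⟩
    2                                                     ∎
    where
    open ≡.≡-Reasoning
    count-single : ∀ c → count (_== c) ≡ 1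
    count-single c = ≡.trans (count-delta c (λ y → ==-false)) (≡.cong toℕ (==-true ≡.refl))
    toℕ-∨ : ∀ y → toℕ ((y == c) ∨ (y == d)) ≡ toℕ (y == c) ℕ.+ toℕ (y == d)
    toℕ-∨ y with y ≟ c | y ≟ d
    ... | yes y≡c | yes y≡d = contradiction (≡.trans (≡.sym y≡c) y≡d) c≢d
    ... | yes _   | no _    = ≡.refl
    ... | no _    | _       = ≡.refl

  -- Characteristic two and Fermat's little theorem

  pow-+ : ∀ x i j → pow x (i ℕ.+ j) ≡ pow x i * pow x j
  pow-+ x zero    j = ≡.sym (*-identityˡ (pow x j))
  pow-+ x (suc i) j = ≡.trans (≡.cong (x *_) (pow-+ x i j)) (≡.sym (*-assoc x (pow x i) (pow x j)))

  pow-distrib-* : ∀ x y i → pow (x * y) i ≡ pow x i * pow y i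
  pow-distrib-* x y zero    = ≡.sym (*-identityˡ 1#)
  pow-distrib-* x y (suc i) = ≡.trans (≡.cong ((x * y) *_) (pow-distrib-* x y i))
    (solve 4 (λ x y a b → (x :* y) :* (a :* b) := (x :* a) :* (y :* b)) ≡.refl x y (pow x i) (pow y i))

  pow-1# : ∀ i → pow 1# i ≡ 1#
  pow-1# zero    = ≡.refl
  pow-1# (suc i) = ≡.trans (*-identityˡ (pow 1# i)) (pow-1# i)

  pow-≡0 : ∀ x i → pow x i ≡ 0# → x ≡ 0#
  pow-≡0 x zero    1≡0 = contradiction 1≡0 1≢0
  pow-≡0 x (suc i) xxⁱ≡0 with *-≡0 x (pow x i) xxⁱ≡0
  ... | inj₁ x≡0   = x≡0
  ... | inj₂ xⁱ≡0 = pow-≡0 x i xⁱ≡0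

  pow-0# : ∀ i → 0 ℕ.< i → pow 0# i ≡ 0#
  pow-0# (suc i) _ = zeroˡ (pow 0# i)

  pow≡× : ∀ x i → pow x i ≡ i ×* x
  pow≡× x zero    = ≡.refl
  pow≡× x (suc i) = ≡.cong (x *_) (pow≡× x i)

  _² : Carrier → Carrier
  x ² = x * x

  pow-2^suc : ∀ x i → pow x (2 ^ suc i) ≡ pow x (2 ^ i) ²
  pow-2^suc x i = ≡.trans (pow-+ x (2 ^ i) (2 ^ i ℕ.+ 0))
                    (≡.cong (λ j → pow x (2 ^ i) * pow x j) (ℕ.+-identityʳ (2 ^ i)))

  1+1≡0 : 1# + 1# ≡ 0#
  1+1≡0 = pow-≡0 (1# + 1#) n (≡.trans (≡.sym (2^i×1≡pow n)) 2^n×1≡0)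
    where
    open ≡.≡-Reasoning
    2^i×1≡pow : ∀ i → (2 ^ i) × 1# ≡ pow (1# + 1#) i
    2^i×1≡pow zero    = +-identityʳ 1#
    2^i×1≡pow (suc i) = begin
      (2 ℕ.* 2 ^ i) × 1#                  ≡⟨ ×1-homo-* 2 (2 ^ i) ⟩
      (1# + (1# + 0#)) * ((2 ^ i) × 1#)   ≡⟨ ≡.cong₂ _*_ (≡.cong (1# +_) (+-identityʳ 1#)) (2^i×1≡pow i) ⟩
      (1# + 1#) * pow (1# + 1#) i         ∎
    -- Translating every element by 1 permutes the field, so the 2ⁿ added ones sum to 0.
    2^n×1≡0 : (2 ^ n) × 1# ≡ 0#
    2^n×1≡0 = identityʳ-unique (Add.∑ id) ((2 ^ n) × 1#) (begin
      Add.∑ id + (2 ^ n) × 1#       ≡⟨ ≡.cong (Add.∑ id +_) (Add.∑-const 1#) ⟨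
      Add.∑ id + Add.∑ (λ _ → 1#)   ≡⟨ Add.∑-distrib id (λ _ → 1#) ⟨
      Add.∑ (λ y → y + 1#)          ≡⟨ Add.∑-reindex (_+ 1#) (_+ - 1#) (//-rightDividesʳ 1#) (//-rightDividesˡ 1#) id ⟩
      Add.∑ id                      ∎)

  x+x≡0 : ∀ x → x + x ≡ 0#
  x+x≡0 x = begin
    x + x                 ≡⟨ solve 1 (λ x → x :+ x := (con 1 :+ con 1) :* x) ≡.refl x ⟩
    (1# + 1#) * x         ≡⟨ ≡.cong (_* x) 1+1≡0 ⟩
    0# * x                ≡⟨ zeroˡ x ⟩
    0#                    ∎
    where open ≡.≡-Reasoning

  -x≡x : ∀ x → - x ≡ x
  -x≡x x = ≡.sym (inverseˡ-unique x x (x+x≡0 x))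

  x+y≡0⇒x≡y : ∀ {x y} → x + y ≡ 0# → x ≡ y
  x+y≡0⇒x≡y {x} {y} x+y≡0 = +-cancelʳ y x y (≡.trans x+y≡0 (≡.sym (x+x≡0 y)))

  +-involutive : ∀ d y → (y + d) + d ≡ y
  +-involutive d y = ≡.trans (+-assoc y d d) (≡.trans (≡.cong (y +_) (x+x≡0 d)) (+-identityʳ y))

  x+[1+1]y≡x : ∀ x y → x + (1# + 1#) * y ≡ x
  x+[1+1]y≡x x y = ≡.trans (≡.cong (λ c → x + c * y) 1+1≡0) (≡.trans (≡.cong (x +_) (zeroˡ y)) (+-identityʳ x))

  -- For x ≠ 0, y ↦ x y permutes the field and nonzero (x y) · correction y = x · nonzero y;
  -- multiplying over all y gives ∏ nonzero · x = x^(2ⁿ) · ∏ nonzero.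
  fermat : ∀ x → pow x (2 ^ n) ≡ x
  fermat x with x ≟ 0#
  ... | yes ≡.refl = pow-0# (2 ^ n) (ℕ.m^n>0 2 n)
  ... | no x≢0    = ≡.sym (*-cancelˡ (∏ nonzero) (Mul.∑-closed (_≢ 0#) 1≢0 *-≢0 nonzero-≢0) (begin
    ∏ nonzero * x                                  ≡⟨ ≡.cong₂ _*_ ∏-dilate ∏-correction ⟨
    ∏ (λ y → nonzero (x * y)) * ∏ correction       ≡⟨ Mul.∑-distrib (λ y → nonzero (x * y)) correction ⟨
    ∏ (λ y → nonzero (x * y) * correction y)       ≡⟨ Mul.∑-cong nonzero-* ⟩
    ∏ (λ y → x * nonzero y)                        ≡⟨ Mul.∑-distrib (λ _ → x) nonzero ⟩
    ∏ (λ _ → x) * ∏ nonzero                        ≡⟨ ≡.cong (_* ∏ nonzero) (≡.trans (Mul.∑-const x) (≡.sym (pow≡× x (2 ^ n)))) ⟩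
    pow x (2 ^ n) * ∏ nonzero                      ≡⟨ *-comm (pow x (2 ^ n)) (∏ nonzero) ⟩
    ∏ nonzero * pow x (2 ^ n)                      ∎))
    where
    open ≡.≡-Reasoning
    ∏ : (Carrier → Carrier) → Carrier
    ∏ = Mul.∑
    nonzero : Carrier → Carrier
    nonzero y = if y == 0# then 1# else y
    correction : Carrier → Carrier
    correction y = if y == 0# then x else 1#
    nonzero-≢0 : ∀ y → nonzero y ≢ 0#
    nonzero-≢0 y with y ≟ 0#
    ... | yes _   = 1≢0
    ... | no y≢0 = y≢0
    correction-off-0 : ∀ y → y ≢ 0# → correction y ≡ 1#
    correction-off-0 y y≢0 = ≡.cong (if_then x else 1#) (==-false y≢0)
    nonzero-* : ∀ y → nonzero (x * y) * correction y ≡ x * nonzero y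
    nonzero-* y with y ≟ 0# | (x * y) ≟ 0#
    ... | yes ≡.refl | yes _     = ≡.trans (*-identityˡ x) (≡.sym (*-identityʳ x))
    ... | yes ≡.refl | no x0≢0  = contradiction (zeroʳ x) x0≢0
    ... | no y≢0     | yes xy≡0 = contradiction xy≡0 (*-≢0 x≢0 y≢0)
    ... | no _       | no _     = *-identityʳ (x * y)
    ∏-correction : ∏ correction ≡ x
    ∏-correction = ≡.trans (Mul.∑-delta 0# correction-off-0) (≡.cong (if_then x else 1#) (==-true ≡.refl))
    x⁻¹*x* : ∀ y → x ⁻¹ * (x * y) ≡ y
    x⁻¹*x* y = ≡.trans (≡.sym (*-assoc (x ⁻¹) x y)) (≡.trans (≡.cong (_* y) (≡.trans (*-comm (x ⁻¹) x) (inverse x x≢0))) (*-identityˡ y))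
    x*x⁻¹* : ∀ y → x * (x ⁻¹ * y) ≡ y
    x*x⁻¹* y = ≡.trans (≡.sym (*-assoc x (x ⁻¹) y)) (≡.trans (≡.cong (_* y) (inverse x x≢0)) (*-identityˡ y))
    ∏-dilate : ∏ (λ y → nonzero (x * y)) ≡ ∏ nonzero
    ∏-dilate = Mul.∑-reindex (x *_) (x ⁻¹ *_) x⁻¹*x* x*x⁻¹* nonzero

  -- The absolute trace

  ²-+ : ∀ x y → (x + y) ² ≡ x ² + y ²
  ²-+ x y = begin
    (x + y) * (x + y)                   ≡⟨ solve 2 (λ x y → (x :+ y) :* (x :+ y) := (x :* x :+ y :* y) :+ (x :* y :+ x :* y)) ≡.refl x y ⟩
    (x * x + y * y) + (x * y + x * y)   ≡⟨ ≡.cong ((x * x + y * y) +_) (x+x≡0 (x * y)) ⟩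
    (x * x + y * y) + 0#                ≡⟨ +-identityʳ (x * x + y * y) ⟩
    x * x + y * y                       ∎
    where open ≡.≡-Reasoning

  pow-2^-distrib-+ : ∀ i x y → pow (x + y) (2 ^ i) ≡ pow x (2 ^ i) + pow y (2 ^ i)
  pow-2^-distrib-+ zero    x y = solve 2 (λ x y → (x :+ y) :* con 1 := x :* con 1 :+ y :* con 1) ≡.refl x y
  pow-2^-distrib-+ (suc i) x y = begin
    pow (x + y) (2 ^ suc i)                 ≡⟨ pow-2^suc (x + y) i ⟩
    pow (x + y) (2 ^ i) ²                   ≡⟨ ≡.cong _² (pow-2^-distrib-+ i x y) ⟩
    (pow x (2 ^ i) + pow y (2 ^ i)) ²       ≡⟨ ²-+ (pow x (2 ^ i)) (pow y (2 ^ i)) ⟩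
    pow x (2 ^ i) ² + pow y (2 ^ i) ²       ≡⟨ ≡.cong₂ _+_ (pow-2^suc x i) (pow-2^suc y i) ⟨
    pow x (2 ^ suc i) + pow y (2 ^ suc i)   ∎
    where open ≡.≡-Reasoning

  sum-² : ∀ {m} (t : Vector Carrier m) → sum t ² ≡ sum (λ i → t i ²)
  sum-² {zero}  t = zeroˡ 0#
  sum-² {suc m} t = ≡.trans (²-+ (t Fin.zero) (sum (t ∘ Fin.suc))) (≡.cong (t Fin.zero ² +_) (sum-² (t ∘ Fin.suc)))

  foldr-map-applyUpTo : ∀ (f : ℕ → Carrier) (g : ℕ → ℕ) m →
                        foldr _+_ 0# (map f (applyUpTo g m)) ≡ sum {m} (λ i → f (g (Fin.toℕ i)))
  foldr-map-applyUpTo f g zero    = ≡.refl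
  foldr-map-applyUpTo f g (suc m) = ≡.cong (f (g 0) +_) (foldr-map-applyUpTo f (g ∘ suc) m)

  Tr-sum : ∀ x → Tr x ≡ sum {n} (λ i → pow x (2 ^ Fin.toℕ i))
  Tr-sum x = foldr-map-applyUpTo (λ i → pow x (2 ^ i)) id n

  Tr-+ : ∀ x y → Tr (x + y) ≡ Tr x + Tr y
  Tr-+ x y = begin
    Tr (x + y)
      ≡⟨ Tr-sum (x + y) ⟩
    sum {n} (λ i → pow (x + y) (2 ^ Fin.toℕ i))
      ≡⟨ sum-cong-≗ {n} (λ i → pow-2^-distrib-+ (Fin.toℕ i) x y) ⟩
    sum {n} (λ i → pow x (2 ^ Fin.toℕ i) + pow y (2 ^ Fin.toℕ i))
      ≡⟨ ∑-distrib-+ {n} _ _ ⟩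
    sum {n} (λ i → pow x (2 ^ Fin.toℕ i)) + sum {n} (λ i → pow y (2 ^ Fin.toℕ i))
      ≡⟨ ≡.cong₂ _+_ (Tr-sum x) (Tr-sum y) ⟨
    Tr x + Tr y
      ∎
    where open ≡.≡-Reasoning

  Tr-²-comm : ∀ x → Tr x ² ≡ Tr (x ²)
  Tr-²-comm x = begin
    Tr x ²                                      ≡⟨ ≡.cong _² (Tr-sum x) ⟩
    sum {n} (λ i → pow x (2 ^ Fin.toℕ i)) ²     ≡⟨ sum-² {n} _ ⟩
    sum {n} (λ i → pow x (2 ^ Fin.toℕ i) ²)     ≡⟨ sum-cong-≗ {n} (λ i → pow-distrib-* x x (2 ^ Fin.toℕ i)) ⟨
    sum {n} (λ i → pow (x ²) (2 ^ Fin.toℕ i))   ≡⟨ Tr-sum (x ²) ⟨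
    Tr (x ²)                                    ∎
    where open ≡.≡-Reasoning

  -- Squaring shifts the conjugates x^(2^i) by one; x^(2ⁿ) = x closes the cycle.
  Tr-² : ∀ x → Tr (x ²) ≡ Tr x
  Tr-² x = +-cancelˡ (pow x 1) _ _ (begin
    pow x 1 + Tr (x ²)                              ≡⟨ ≡.cong (pow x 1 +_) (≡.trans (Tr-sum (x ²)) (sum-cong-≗ {n} shift)) ⟩
    sum {suc n} (conj ∘ Fin.toℕ)                    ≡⟨ sum-init-last {n} (conj ∘ Fin.toℕ) ⟩
    sum {n} (conj ∘ Fin.toℕ ∘ Fin.inject₁) + conj (Fin.toℕ (Fin.fromℕ n))
        ≡⟨ ≡.cong₂ _+_ (sum-cong-≗ {n} (≡.cong conj ∘ toℕ-inject₁)) (≡.cong conj (toℕ-fromℕ n)) ⟩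
    sum {n} (conj ∘ Fin.toℕ) + pow x (2 ^ n)        ≡⟨ ≡.cong₂ _+_ (≡.sym (Tr-sum x)) (≡.trans (fermat x) (≡.sym (*-identityʳ x))) ⟩
    Tr x + pow x 1                                  ≡⟨ +-comm (Tr x) (pow x 1) ⟩
    pow x 1 + Tr x                                  ∎)
    where
    open ≡.≡-Reasoning
    conj : ℕ → Carrier
    conj i = pow x (2 ^ i)
    shift : ∀ i → pow (x ²) (2 ^ Fin.toℕ i) ≡ conj (suc (Fin.toℕ i))
    shift i = ≡.trans (pow-distrib-* x x (2 ^ Fin.toℕ i)) (≡.sym (pow-2^suc x (Fin.toℕ i)))

  IsBit : Carrier → Set
  IsBit x = x ≡ 0# ⊎ x ≡ 1#

  ²-idem⇒bit : ∀ x → x ² ≡ x → IsBit x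
  ²-idem⇒bit x x²≡x = [ inj₁ , inj₂ ∘ x+y≡0⇒x≡y ] (*-≡0 x (x + 1#) x[x+1]≡0)
    where
    open ≡.≡-Reasoning
    x[x+1]≡0 : x * (x + 1#) ≡ 0#
    x[x+1]≡0 = begin
      x * (x + 1#)   ≡⟨ solve 1 (λ x → x :* (x :+ con 1) := x :* x :+ x) ≡.refl x ⟩
      x ² + x        ≡⟨ ≡.cong (_+ x) x²≡x ⟩
      x + x          ≡⟨ x+x≡0 x ⟩
      0#             ∎

  Tr-bit : ∀ x → IsBit (Tr x)
  Tr-bit x = ²-idem⇒bit (Tr x) (≡.trans (Tr-²-comm x) (Tr-² x))

  bit-+1 : ∀ {u} → IsBit u → ((u + 1#) == 0#) ≡ not (u == 0#)
  bit-+1 (inj₁ ≡.refl) = ≡.trans (==-false (λ 0+1≡0 → 1≢0 (≡.trans (≡.sym (+-identityˡ 1#)) 0+1≡0)))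
                                 (≡.cong not (≡.sym (==-true ≡.refl)))
  bit-+1 (inj₂ ≡.refl) = ≡.trans (==-true 1+1≡0) (≡.cong not (≡.sym (==-false 1≢0)))

  bit-+ : ∀ {u w} → IsBit u → IsBit w → ((u + w) == 0#) ≡ not ((u == 0#) xor (w == 0#))
  bit-+ {w = w} (inj₁ ≡.refl) _ = begin
    (0# + w) == 0#                  ≡⟨ ≡.cong (_== 0#) (+-identityˡ w) ⟩
    w == 0#                         ≡⟨ not-involutive (w == 0#) ⟨
    not (true xor (w == 0#))        ≡⟨ ≡.cong (λ b → not (b xor (w == 0#))) (==-true ≡.refl) ⟨
    not ((0# == 0#) xor (w == 0#))  ∎
    where open ≡.≡-Reasoning
  bit-+ {w = w} (inj₂ ≡.refl) w-bit = begin
    (1# + w) == 0#                  ≡⟨ ≡.cong (_== 0#) (+-comm 1# w) ⟩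
    (w + 1#) == 0#                  ≡⟨ bit-+1 w-bit ⟩
    not (false xor (w == 0#))       ≡⟨ ≡.cong (λ b → not (b xor (w == 0#))) (==-false 1≢0) ⟨
    not ((1# == 0#) xor (w == 0#))  ∎
    where open ≡.≡-Reasoning

  -- Balanced predicates and difference counts

  Balanced : (Carrier → Bool) → Set
  Balanced P = 2 ℕ.* count P ≡ 2 ^ n

  flip⇒balanced : ∀ (P : Carrier → Bool) d → (∀ y → P (y + d) ≡ not (P y)) → Balanced P
  flip⇒balanced P d P-flip = begin
    count P ℕ.+ (count P ℕ.+ 0)      ≡⟨ ≡.cong (count P ℕ.+_) (ℕ.+-identityʳ (count P)) ⟩
    count P ℕ.+ count P              ≡⟨ ≡.cong (ℕ._+ count P) (count-reindex (_+ d) (_+ d) (+-involutive d) (+-involutive d) P) ⟨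
    count (P ∘ (_+ d)) ℕ.+ count P   ≡⟨ ≡.cong (ℕ._+ count P) (count-cong P-flip) ⟩
    count (not ∘ P) ℕ.+ count P      ≡⟨ count-complement P ⟩
    2 ^ n                            ∎
    where open ≡.≡-Reasoning

  -- Pointwise, [X] + [Y] + [X ⇔ Y] = 2 [X ∧ Y] + 1.
  count-inclusion-exclusion : ∀ (X Y : Carrier → Bool) →
    count X ℕ.+ count Y ℕ.+ count (λ y → not (X y xor Y y)) ≡
    count (λ y → X y ∧ Y y) ℕ.+ count (λ y → X y ∧ Y y) ℕ.+ 2 ^ n
  count-inclusion-exclusion X Y = begin
    count X ℕ.+ count Y ℕ.+ count E
        ≡⟨ ≡.cong₂ ℕ._+_ (≡.cong₂ ℕ._+_ (count-∑ X) (count-∑ Y)) (count-∑ E) ⟩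
    Count.∑ (toℕ ∘ X) ℕ.+ Count.∑ (toℕ ∘ Y) ℕ.+ Count.∑ (toℕ ∘ E)
        ≡⟨ ∑-+₃ (toℕ ∘ X) (toℕ ∘ Y) (toℕ ∘ E) ⟨
    Count.∑ (λ y → toℕ (X y) ℕ.+ toℕ (Y y) ℕ.+ toℕ (E y))
        ≡⟨ Count.∑-cong (λ y → pointwise (X y) (Y y)) ⟩
    Count.∑ (λ y → toℕ (Z y) ℕ.+ toℕ (Z y) ℕ.+ 1)
        ≡⟨ ∑-+₃ (toℕ ∘ Z) (toℕ ∘ Z) (λ _ → 1) ⟩
    Count.∑ (toℕ ∘ Z) ℕ.+ Count.∑ (toℕ ∘ Z) ℕ.+ Count.∑ (λ _ → 1)
        ≡⟨ ≡.cong₂ ℕ._+_ (≡.cong₂ ℕ._+_ (count-∑ Z) (count-∑ Z)) (≡.trans (≡.sym count-all) (count-∑ (λ _ → true))) ⟨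
    count Z ℕ.+ count Z ℕ.+ 2 ^ n
        ∎
    where
    open ≡.≡-Reasoning
    E Z : Carrier → Bool
    E y = not (X y xor Y y)
    Z y = X y ∧ Y y
    pointwise : ∀ x y → toℕ x ℕ.+ toℕ y ℕ.+ toℕ (not (x xor y)) ≡ toℕ (x ∧ y) ℕ.+ toℕ (x ∧ y) ℕ.+ 1
    pointwise true  true  = ≡.refl
    pointwise true  false = ≡.refl
    pointwise false true  = ≡.refl
    pointwise false false = ≡.refl
    ∑-+₃ : ∀ f g h → Count.∑ (λ y → f y ℕ.+ g y ℕ.+ h y) ≡ Count.∑ f ℕ.+ Count.∑ g ℕ.+ Count.∑ h
    ∑-+₃ f g h = ≡.trans (Count.∑-distrib (λ y → f y ℕ.+ g y) h) (≡.cong (ℕ._+ Count.∑ h) (Count.∑-distrib f g))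

  balanced-∧ : ∀ (X Y : Carrier → Bool) →
               Balanced X → Balanced Y → Balanced (λ y → not (X y xor Y y)) →
               4 ℕ.* count (λ y → X y ∧ Y y) ≡ 2 ^ n
  balanced-∧ X Y 2X≡q 2Y≡q 2E≡q = ℕ.+-cancelʳ-≡ (2 ℕ.* q) (4 ℕ.* z) q (begin
    4 ℕ.* z ℕ.+ 2 ℕ.* q                  ≡⟨ 4z+2q≡2[z+z+q] z q ⟩
    2 ℕ.* (z ℕ.+ z ℕ.+ q)                ≡⟨ ≡.cong (2 ℕ.*_) (count-inclusion-exclusion X Y) ⟨
    2 ℕ.* (cX ℕ.+ cY ℕ.+ cE)             ≡⟨ 2[x+y+e]≡2x+2y+2e cX cY cE ⟩
    2 ℕ.* cX ℕ.+ 2 ℕ.* cY ℕ.+ 2 ℕ.* cE   ≡⟨ ≡.cong₂ ℕ._+_ (≡.cong₂ ℕ._+_ 2X≡q 2Y≡q) 2E≡q ⟩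
    q ℕ.+ q ℕ.+ q                        ≡⟨ q+q+q≡q+2q q ⟩
    q ℕ.+ 2 ℕ.* q                        ∎)
    where
    open ≡.≡-Reasoning
    q cX cY cE z : ℕ
    q = 2 ^ n
    cX = count X
    cY = count Y
    cE = count (λ y → not (X y xor Y y))
    z = count (λ y → X y ∧ Y y)
    4z+2q≡2[z+z+q] : ∀ z q → 4 ℕ.* z ℕ.+ 2 ℕ.* q ≡ 2 ℕ.* (z ℕ.+ z ℕ.+ q)
    4z+2q≡2[z+z+q] = solve-∀
    2[x+y+e]≡2x+2y+2e : ∀ x y e → 2 ℕ.* (x ℕ.+ y ℕ.+ e) ≡ 2 ℕ.* x ℕ.+ 2 ℕ.* y ℕ.+ 2 ℕ.* e
    2[x+y+e]≡2x+2y+2e = solve-∀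
    q+q+q≡q+2q : ∀ q → q ℕ.+ q ℕ.+ q ≡ q ℕ.+ 2 ℕ.* q
    q+q+q≡q+2q = solve-∀

  differences : (Carrier → Bool) → Carrier → ℕ
  differences P g = count₂ (λ r r′ → P r ∧ P r′ ∧ not (r == r′) ∧ ((r + - r′) == g))

  -- In characteristic 2, r − r′ = g exactly when r′ = r + g.
  differences-count : ∀ (P : Carrier → Bool) {g} → g ≢ 0# → differences P g ≡ count (λ r → P r ∧ P (r + g))
  differences-count P {g} g≢0 = begin
    count₂ Q                                  ≡⟨ count₂-∑ Q ⟩
    Count.∑ (λ r → count (Q r))               ≡⟨ Count.∑-cong (λ r → count-delta (r + g) (Q-off r)) ⟩
    Count.∑ (λ r → toℕ (Q r (r + g)))         ≡⟨ Count.∑-cong (λ r → ≡.cong toℕ (Q-on r)) ⟩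
    Count.∑ (λ r → toℕ (P r ∧ P (r + g)))     ≡⟨ count-∑ (λ r → P r ∧ P (r + g)) ⟨
    count (λ r → P r ∧ P (r + g))             ∎
    where
    open ≡.≡-Reasoning
    Q : Carrier → Carrier → Bool
    Q r r′ = P r ∧ P r′ ∧ not (r == r′) ∧ ((r + - r′) == g)
    Q-off : ∀ r r′ → r′ ≢ r + g → Q r r′ ≡ false
    Q-off r r′ r′≢r+g = begin
      P r ∧ P r′ ∧ not (r == r′) ∧ ((r + - r′) == g) ≡⟨ ≡.cong (λ b → P r ∧ P r′ ∧ not (r == r′) ∧ b) (==-false r-r′≢g) ⟩
      P r ∧ P r′ ∧ not (r == r′) ∧ false             ≡⟨ ≡.cong (λ b → P r ∧ P r′ ∧ b) (∧-zeroʳ (not (r == r′))) ⟩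
      P r ∧ P r′ ∧ false                             ≡⟨ ≡.cong (P r ∧_) (∧-zeroʳ (P r′)) ⟩
      P r ∧ false                                    ≡⟨ ∧-zeroʳ (P r) ⟩
      false                                          ∎
      where
      r-r′≢g : r + - r′ ≢ g
      r-r′≢g r-r′≡g = r′≢r+g (begin
        r′                  ≡⟨ +-involutive r r′ ⟨
        (r′ + r) + r        ≡⟨ ≡.cong (_+ r) (≡.trans (+-comm r′ r) (≡.cong (r +_) (≡.sym (-x≡x r′)))) ⟩
        (r + - r′) + r      ≡⟨ ≡.cong (_+ r) r-r′≡g ⟩
        g + r               ≡⟨ +-comm g r ⟩
        r + g               ∎)
    Q-on : ∀ r → Q r (r + g) ≡ P r ∧ P (r + g)
    Q-on r = begin
      P r ∧ P (r + g) ∧ not (r == (r + g)) ∧ ((r + - (r + g)) == g)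
          ≡⟨ ≡.cong₂ (λ b c → P r ∧ P (r + g) ∧ not b ∧ c) (==-false r≢r+g) (==-true r-[r+g]≡g) ⟩
      P r ∧ P (r + g) ∧ true
          ≡⟨ ≡.cong (P r ∧_) (∧-identityʳ (P (r + g))) ⟩
      P r ∧ P (r + g)
          ∎
      where
      r≢r+g : r ≢ r + g
      r≢r+g r≡r+g = g≢0 (+-cancelˡ r g 0# (≡.trans (≡.sym r≡r+g) (≡.sym (+-identityʳ r))))
      r-[r+g]≡g : r + - (r + g) ≡ g
      r-[r+g]≡g = begin
        r + - (r + g)   ≡⟨ ≡.cong (r +_) (-x≡x (r + g)) ⟩
        r + (r + g)     ≡⟨ ≡.cong (r +_) (+-comm r g) ⟩
        r + (g + r)     ≡⟨ +-comm r (g + r) ⟩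
        (g + r) + r     ≡⟨ +-involutive r g ⟩
        g               ∎

  zeroOr : Carrier → Carrier → Bool
  zeroOr b y = (y == 0#) ∨ (y == b)

  zeroOr-true : ∀ {b y} → zeroOr b y ≡ true → y ≡ 0# ⊎ y ≡ b
  zeroOr-true {b} {y} y∈ with y ≟ 0# | y ≟ b
  ... | yes y≡0 | _       = inj₁ y≡0
  ... | no _    | yes y≡b = inj₂ y≡b

  zeroOr-intro : ∀ {b y} → y ≡ 0# ⊎ y ≡ b → zeroOr b y ≡ true
  zeroOr-intro {b} {y} (inj₁ y≡0) = ≡.cong (_∨ (y == b)) (==-true y≡0)
  zeroOr-intro {b} {y} (inj₂ y≡b) = ≡.trans (≡.cong ((y == 0#) ∨_) (==-true y≡b)) (∨-zeroʳ (y == 0#))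

  zeroOr-false : ∀ {b y} → zeroOr b y ≡ false → y ≢ 0# Prod.× y ≢ b
  zeroOr-false y∉ = (λ y≡0 → true≢false (≡.trans (≡.sym (zeroOr-intro (inj₁ y≡0))) y∉))
                  , (λ y≡b → true≢false (≡.trans (≡.sym (zeroOr-intro (inj₂ y≡b))) y∉))
    where
    true≢false : true ≢ false
    true≢false ()

  zeroOr-closed : ∀ {b} x y → zeroOr b x ≡ true → zeroOr b y ≡ true → zeroOr b (x + - y) ≡ true
  zeroOr-closed {b} x y x∈ y∈ =
    zeroOr-intro (≡.subst (λ z → z ≡ 0# ⊎ z ≡ b) (≡.cong (x +_) (≡.sym (-x≡x y))) (sum∈ (zeroOr-true x∈) (zeroOr-true y∈)))
    where
    sum∈ : x ≡ 0# ⊎ x ≡ b → y ≡ 0# ⊎ y ≡ b → x + y ≡ 0# ⊎ x + y ≡ b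
    sum∈ (inj₁ ≡.refl) (inj₁ ≡.refl) = inj₁ (+-identityʳ 0#)
    sum∈ (inj₁ ≡.refl) (inj₂ ≡.refl) = inj₂ (+-identityˡ b)
    sum∈ (inj₂ ≡.refl) (inj₁ ≡.refl) = inj₂ (+-identityʳ b)
    sum∈ (inj₂ ≡.refl) (inj₂ ≡.refl) = inj₁ (x+x≡0 b)

  count-zeroOr : ∀ {b} → b ≢ 0# → count (zeroOr b) ≡ 2
  count-zeroOr b≢0 = count-pair (b≢0 ∘ ≡.sym)

  module OddDegree (k : ℕ) (n≡2k+1 : n ≡ suc (k ℕ.+ k)) where

    Tr-1# : Tr 1# ≡ 1#
    Tr-1# = begin
      Tr 1#                                   ≡⟨ Tr-sum 1# ⟩
      sum {n} (λ i → pow 1# (2 ^ Fin.toℕ i))  ≡⟨ sum-cong-≗ {n} (λ i → pow-1# (2 ^ Fin.toℕ i)) ⟩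
      sum {n} (λ _ → 1#)                      ≡⟨ sum-replicate n ⟩
      n × 1#                                  ≡⟨ ≡.cong (_× 1#) n≡2k+1 ⟩
      1# + (k ℕ.+ k) × 1#                     ≡⟨ ≡.cong (1# +_) (≡.trans (×-homo-+ 1# k k) (x+x≡0 (k × 1#))) ⟩
      1# + 0#                                 ≡⟨ +-identityʳ 1# ⟩
      1#                                      ∎
      where open ≡.≡-Reasoning

    √ : Carrier → Carrier
    √ x = pow x (2 ^ (k ℕ.+ k))

    √-² : ∀ x → √ x ² ≡ x
    √-² x = begin
      √ x ²                        ≡⟨ pow-2^suc x (k ℕ.+ k) ⟨
      pow x (2 ^ suc (k ℕ.+ k))    ≡⟨ ≡.cong (λ m → pow x (2 ^ m)) n≡2k+1 ⟨
      pow x (2 ^ n)                ≡⟨ fermat x ⟩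
      x                            ∎
      where open ≡.≡-Reasoning

    -- x⁴ = x gives x^(2^(2k)) = x, i.e. √ x = x, so x² = (√ x)² = x.
    ⁴-fixed⇒bit : ∀ x → x ² ² ≡ x → IsBit x
    ⁴-fixed⇒bit x x⁴≡x = ²-idem⇒bit x (≡.trans (≡.cong _² (≡.sym (pow-2^[j+j] k))) (√-² x))
      where
      open ≡.≡-Reasoning
      pow-2^[j+j] : ∀ j → pow x (2 ^ (j ℕ.+ j)) ≡ x
      pow-2^[j+j] zero    = *-identityʳ x
      pow-2^[j+j] (suc j) = begin
        pow x (2 ^ suc (j ℕ.+ suc j))     ≡⟨ ≡.cong (λ m → pow x (2 ^ suc m)) (ℕ.+-suc j j) ⟩
        pow x (2 ^ suc (suc (j ℕ.+ j)))   ≡⟨ pow-2^suc x (suc (j ℕ.+ j)) ⟩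
        pow x (2 ^ suc (j ℕ.+ j)) ²       ≡⟨ ≡.cong _² (pow-2^suc x (j ℕ.+ j)) ⟩
        pow x (2 ^ (j ℕ.+ j)) ² ²         ≡⟨ ≡.cong (λ z → z ² ²) (pow-2^[j+j] j) ⟩
        x ² ²                             ≡⟨ x⁴≡x ⟩
        x                                 ∎

    √≡²⇒bit : ∀ x → √ x ≡ x ² → IsBit x
    √≡²⇒bit x √x≡x² = ⁴-fixed⇒bit x (≡.trans (≡.cong _² (≡.sym √x≡x²)) (√-² x))

    Tr-affine-balanced : ∀ {c} e → c ≢ 0# → Balanced (λ y → Tr (c * y + e) == 0#)
    Tr-affine-balanced {c} e c≢0 = flip⇒balanced (λ y → Tr (c * y + e) == 0#) (c ⁻¹) (λ y → begin
      Tr (c * (y + c ⁻¹) + e) == 0#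
          ≡⟨ ≡.cong (λ z → Tr z == 0#) (solve 4 (λ c y c' e → c :* (y :+ c') :+ e := (c :* y :+ e) :+ c :* c') ≡.refl c y (c ⁻¹) e) ⟩
      Tr ((c * y + e) + c * c ⁻¹) == 0#
          ≡⟨ ≡.cong (_== 0#) (≡.trans (Tr-+ (c * y + e) (c * c ⁻¹)) (≡.cong (λ z → Tr (c * y + e) + Tr z) (inverse c c≢0))) ⟩
      (Tr (c * y + e) + Tr 1#) == 0#     ≡⟨ ≡.cong (λ z → (Tr (c * y + e) + z) == 0#) Tr-1# ⟩
      (Tr (c * y + e) + 1#) == 0#        ≡⟨ bit-+1 (Tr-bit (c * y + e)) ⟩
      not (Tr (c * y + e) == 0#)         ∎)
      where open ≡.≡-Reasoning

    cube : Carrier → Carrier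
    cube x = x * x * x

    -- (u + v)³ + u³ = u²v + uv² + v³ in characteristic 2, and Tr(u²v) = Tr((u √v)²) = Tr(u √v).
    Tr-cube-difference : ∀ u v → Tr (cube (u + v)) + Tr (cube u) ≡ Tr ((√ v + v ²) * u + cube v)
    Tr-cube-difference u v = begin
      Tr (cube (u + v)) + Tr (cube u)                 ≡⟨ Tr-+ (cube (u + v)) (cube u) ⟨
      Tr (cube (u + v) + cube u)                      ≡⟨ ≡.cong Tr expand ⟩
      Tr (u * u * v + (u * v * v + cube v))           ≡⟨ Tr-+ (u * u * v) (u * v * v + cube v) ⟩
      Tr (u * u * v) + Tr (u * v * v + cube v)        ≡⟨ ≡.cong (_+ Tr (u * v * v + cube v)) Tr-u²v ⟩
      Tr (u * √ v) + Tr (u * v * v + cube v)          ≡⟨ Tr-+ (u * √ v) (u * v * v + cube v) ⟨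
      Tr (u * √ v + (u * v * v + cube v))
          ≡⟨ ≡.cong Tr (solve 4 (λ u s v c → u :* s :+ (u :* v :* v :+ c) := (s :+ v :* v) :* u :+ c) ≡.refl u (√ v) v (cube v)) ⟩
      Tr ((√ v + v ²) * u + cube v)                   ∎
      where
      open ≡.≡-Reasoning
      expand : cube (u + v) + cube u ≡ u * u * v + (u * v * v + cube v)
      expand = ≡.trans
        (solve 2 (λ u v → (u :+ v) :* (u :+ v) :* (u :+ v) :+ u :* u :* u
                    := (u :* u :* v :+ (u :* v :* v :+ v :* v :* v))
                       :+ (con 1 :+ con 1) :* (u :* u :* u :+ u :* u :* v :+ u :* v :* v)) ≡.refl u v)
        (x+[1+1]y≡x _ _)
      Tr-u²v : Tr (u * u * v) ≡ Tr (u * √ v)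
      Tr-u²v = begin
        Tr (u * u * v)           ≡⟨ ≡.cong (λ z → Tr (u * u * z)) (√-² v) ⟨
        Tr (u * u * √ v ²)       ≡⟨ ≡.cong Tr (solve 2 (λ u s → u :* u :* (s :* s) := (u :* s) :* (u :* s)) ≡.refl u (√ v)) ⟩
        Tr ((u * √ v) ²)         ≡⟨ Tr-² (u * √ v) ⟩
        Tr (u * √ v)             ∎

    module Construction (a : Carrier) (a≢0 : a ≢ 0#) where

      b : Carrier
      b = a ⁻¹

      t : Carrier → Carrier
      t y = Tr (pow a 3 * pow y 3)

      R : Carrier → Bool
      R y = t y == 0#

      slope : Carrier → Carrier
      slope g = a * (√ (a * g) + (a * g) ²)

      t-difference : ∀ g y → t (y + g) + t y ≡ Tr (slope g * y + cube (a * g))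
      t-difference g y = begin
        t (y + g) + t y                                     ≡⟨ ≡.cong₂ _+_ (t≡ (y + g)) (t≡ y) ⟩
        Tr (cube (a * (y + g))) + Tr (cube (a * y))         ≡⟨ ≡.cong (λ z → Tr (cube z) + Tr (cube (a * y))) (distribˡ a y g) ⟩
        Tr (cube (a * y + a * g)) + Tr (cube (a * y))       ≡⟨ Tr-cube-difference (a * y) (a * g) ⟩
        Tr ((√ (a * g) + (a * g) ²) * (a * y) + cube (a * g))
            ≡⟨ ≡.cong (λ z → Tr (z + cube (a * g))) (solve 3 (λ s a y → s :* (a :* y) := (a :* s) :* y) ≡.refl (√ (a * g) + (a * g) ²) a y) ⟩
        Tr (slope g * y + cube (a * g))                     ∎
        where
        open ≡.≡-Reasoning
        t≡ : ∀ y → t y ≡ Tr (cube (a * y))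
        t≡ y = ≡.cong Tr (solve 2 (λ a y → (a :* (a :* (a :* con 1))) :* (y :* (y :* (y :* con 1))) := (a :* y) :* (a :* y) :* (a :* y)) ≡.refl a y)

      t-shift : ∀ y → t (y + b) ≡ t y + 1#
      t-shift y = begin
        t (y + b)                                 ≡⟨ +-involutive (t y) (t (y + b)) ⟨
        (t (y + b) + t y) + t y                   ≡⟨ ≡.cong (_+ t y) (t-difference b y) ⟩
        Tr (slope b * y + cube (a * b)) + t y     ≡⟨ ≡.cong₂ (λ s v → Tr (s * y + cube v) + t y) slope-b ab≡1 ⟩
        Tr (0# * y + cube 1#) + t y               ≡⟨ ≡.cong (λ z → Tr z + t y) (solve 1 (λ y → con 0 :* y :+ con 1 :* con 1 :* con 1 := con 1) ≡.refl y) ⟩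
        Tr 1# + t y                               ≡⟨ ≡.cong (_+ t y) Tr-1# ⟩
        1# + t y                                  ≡⟨ +-comm 1# (t y) ⟩
        t y + 1#                                  ∎
        where
        open ≡.≡-Reasoning
        ab≡1 : a * b ≡ 1#
        ab≡1 = inverse a a≢0
        slope-b : slope b ≡ 0#
        slope-b = begin
          a * (√ (a * b) + (a * b) ²)   ≡⟨ ≡.cong (λ v → a * (√ v + v ²)) ab≡1 ⟩
          a * (√ 1# + 1# ²)             ≡⟨ ≡.cong₂ (λ s u → a * (s + u)) (pow-1# (2 ^ (k ℕ.+ k))) (*-identityʳ 1#) ⟩
          a * (1# + 1#)                 ≡⟨ ≡.cong (a *_) 1+1≡0 ⟩
          a * 0#                        ≡⟨ zeroʳ a ⟩
          0#                            ∎

      R-shift : ∀ y → R (y + b) ≡ not (R y)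
      R-shift y = ≡.trans (≡.cong (_== 0#) (t-shift y)) (bit-+1 (Tr-bit _))

      slope-≢0 : ∀ {g} → g ≢ 0# → g ≢ b → slope g ≢ 0#
      slope-≢0 {g} g≢0 g≢b slope≡0 with *-≡0 a (√ (a * g) + (a * g) ²) slope≡0
      ... | inj₁ a≡0       = a≢0 a≡0
      ... | inj₂ √v+v²≡0 with √≡²⇒bit (a * g) (x+y≡0⇒x≡y √v+v²≡0)
      ...   | inj₁ ag≡0 = [ a≢0 , g≢0 ] (*-≡0 a g ag≡0)
      ...   | inj₂ ag≡1 = g≢b (*-cancelˡ a a≢0 (≡.trans ag≡1 (≡.sym (inverse a a≢0))))

      fMap-on-R : ∀ y → t y ≡ 0# → fMap a y ≡ y
      fMap-on-R y ty≡0 = ≡.trans (≡.cong (λ z → y + b * z) ty≡0) (≡.trans (≡.cong (y +_) (zeroʳ b)) (+-identityʳ y))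

      t-fMap : ∀ x → t (fMap a x) ≡ 0#
      t-fMap x with Tr-bit (pow a 3 * pow x 3)
      ... | inj₁ tx≡0 = ≡.trans (≡.cong t (fMap-on-R x tx≡0)) tx≡0
      ... | inj₂ tx≡1 = begin
        t (x + b * t x)    ≡⟨ ≡.cong (λ z → t (x + b * z)) tx≡1 ⟩
        t (x + b * 1#)     ≡⟨ ≡.cong (λ z → t (x + z)) (*-identityʳ b) ⟩
        t (x + b)          ≡⟨ t-shift x ⟩
        t x + 1#           ≡⟨ ≡.cong (_+ 1#) tx≡1 ⟩
        1# + 1#            ≡⟨ 1+1≡0 ⟩
        0#                 ∎
        where open ≡.≡-Reasoning

      image-fMap : ∀ y → image (fMap a) y ≡ R y
      image-fMap y = ⇔→≡ {z = true} (mk⇔ image⇒R R⇒image)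
        where
        image⇒R : image (fMap a) y ≡ true → R y ≡ true
        image⇒R y∈ with image-elim y∈
        ... | x , fx≡y = ==-true (≡.trans (≡.cong t (≡.sym fx≡y)) (t-fMap x))
        R⇒image : R y ≡ true → image (fMap a) y ≡ true
        R⇒image Ry = image-intro y (fMap-on-R y (==-sound Ry))

      image-balanced : Balanced (image (fMap a))
      image-balanced = ≡.trans (≡.cong (2 ℕ.*_) (count-cong image-fMap)) (flip⇒balanced R b R-shift)

      differences-R : ∀ {g} → g ≢ 0# → differences (image (fMap a)) g ≡ count (λ y → R y ∧ R (y + g))
      differences-R {g} g≢0 = ≡.trans (differences-count (image (fMap a)) g≢0)
        (count-cong (λ y → ≡.cong₂ _∧_ (image-fMap y) (image-fMap (y + g))))

      differences-outside : ∀ {g} → zeroOr b g ≡ false → 4 ℕ.* differences (image (fMap a)) g ≡ 2 ^ n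
      differences-outside {g} g∉N = begin
        4 ℕ.* differences (image (fMap a)) g    ≡⟨ ≡.cong (4 ℕ.*_) (differences-R g≢0) ⟩
        4 ℕ.* count (λ y → R y ∧ R (y + g))
            ≡⟨ balanced-∧ R (R ∘ (_+ g)) (flip⇒balanced R b R-shift) (flip⇒balanced (R ∘ (_+ g)) b R+g-shift) agreement-balanced ⟩
        2 ^ n                                   ∎
        where
        open ≡.≡-Reasoning
        g≢0 : g ≢ 0#
        g≢0 = Prod.proj₁ (zeroOr-false g∉N)
        g≢b : g ≢ b
        g≢b = Prod.proj₂ (zeroOr-false g∉N)
        R+g-shift : ∀ y → R ((y + b) + g) ≡ not (R (y + g))
        R+g-shift y = ≡.trans (≡.cong R (solve 3 (λ y b g → (y :+ b) :+ g := (y :+ g) :+ b) ≡.refl y b g)) (R-shift (y + g))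
        agreement : ∀ y → not (R y xor R (y + g)) ≡ (Tr (slope g * y + cube (a * g)) == 0#)
        agreement y = begin
          not (R y xor R (y + g))                ≡⟨ bit-+ (Tr-bit _) (Tr-bit _) ⟨
          (t y + t (y + g)) == 0#                ≡⟨ ≡.cong (_== 0#) (≡.trans (+-comm (t y) (t (y + g))) (t-difference g y)) ⟩
          Tr (slope g * y + cube (a * g)) == 0#  ∎
        agreement-balanced : Balanced (λ y → not (R y xor R (y + g)))
        agreement-balanced = ≡.trans (≡.cong (2 ℕ.*_) (count-cong agreement)) (Tr-affine-balanced (cube (a * g)) (slope-≢0 g≢0 g≢b))

      differences-inside : ∀ {g} → zeroOr b g ≡ true → g ≢ 0# → differences (image (fMap a)) g ≡ 0
      differences-inside g∈N g≢0 with zeroOr-true g∈N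
      ... | inj₁ g≡0    = contradiction g≡0 g≢0
      ... | inj₂ ≡.refl = ≡.trans (differences-R (⁻¹-≢0 a a≢0))
                            (count-none (λ y → ≡.trans (≡.cong (R y ∧_) (R-shift y)) (∧-inverseʳ (R y))))

-- Opened only now: inside FiniteField, _+_ and _*_ are the field operations.
open import Data.Nat using (_+_; _*_; _∸_; _≤_)

mainTheorem1 : (k : ℕ) → 1 ≤ k → (F : GF2 (2 * k + 1)) →
    (a : GF2.Carrier F) → a ≢ GF2.0# F →
    GF2.IsRDS F (GF2.image F (GF2.fMap F a)) (GF2.NSet F a)
      (2 ^ (2 * k)) 2 (2 ^ (2 * k)) (2 ^ (2 * k ∸ 1))
mainTheorem1 k k≥1 F a a≢0 = record
  { group-order = 2^[2k+1]≡2^2k*2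
  ; N-zero      = zeroOr-intro (inj₁ ≡.refl)
  ; N-closed    = zeroOr-closed
  ; N-order     = count-zeroOr (⁻¹-≢0 a a≢0)
  ; R-size      = ℕ.*-cancelˡ-≡ _ _ 2 (≡.trans image-balanced (≡.trans 2^[2k+1]≡2^2k*2 (ℕ.*-comm (2 ^ (2 * k)) 2)))
  ; diffs-out   = λ g g∉N → ℕ.*-cancelˡ-≡ _ _ 4 (≡.trans (differences-outside g∉N) (2^[2m+1]≡4*2^[2m∸1] k k≥1))
  ; diffs-in    = λ g → differences-inside
  }
  where
  open FiniteField F
  open OddDegree k (≡.trans (ℕ.+-comm (2 * k) 1) (≡.cong (λ m → suc (k + m)) (ℕ.+-identityʳ k)))
  open Construction a a≢0
  2^[2k+1]≡2^2k*2 : 2 ^ (2 * k + 1) ≡ 2 ^ (2 * k) * 2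
  2^[2k+1]≡2^2k*2 = ℕ.^-distribˡ-+-* 2 (2 * k) 1
  2^[2m+1]≡4*2^[2m∸1] : ∀ m → 1 ≤ m → 2 ^ (2 * m + 1) ≡ 4 * 2 ^ (2 * m ∸ 1)
  2^[2m+1]≡4*2^[2m∸1] (suc j) _ = ≡.trans (≡.cong (λ e → 2 ^ suc e) (ℕ.+-comm (2 * suc j ∸ 1) 1))
                                          (≡.sym (ℕ.*-assoc 2 2 (2 ^ (2 * suc j ∸ 1))))
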